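{- For all integers $k,n\ge 1$, $$p^k_n=k^n+\sum_{s=0}^{n-1}\binom{n}{s}\,k^s\,p^0_{n-s}.$$
   Context: A preferential arrangement of a finite set $S$ is an ordered set partition of $S$ (a sequence of nonempty pairwise disjoint blocks with union $S$); the empty set has exactly one. Let $a(w)$ be the number of preferential arrangements of a $w$-element set ($a(0)=1$). A barred preferential arrangement of $X_n=\{1,\dots,n\}$ with $k$ bars is a sequence of $k+1$ possibly empty, pairwise disjoint sections with union $X_n$, each equipped with a preferential arrangement of its elements. A restricted section is one whose preferential arrangement has at most one block; a free section may carry any preferential arrangement. For $k\ge0$, $p^k_n$ is the number of barred preferential arrangements of $X_n$ with $k$ bars in which one fixed section is free and the other $k$ sections are restricted; equivalently $p^k_n=\sum_{w_1+\cdots+w_{k+1}=n}\frac{n!}{w_1!\cdots w_{k+1}!}a(w_{1})$ (sum over nonnegative integer solutions). In particular $p^0_n=a(n)$. -}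

module Defs where

open import Data.Nat using (ℕ; zero; suc; _+_; _*_; _∸_)
open import Data.Nat.Combinatorics using (_C_)
open import Data.Bool using (Bool; true; false; _∧_; _∨_)
open import Data.Fin using (Fin; _≟_)
open import Data.Fin.Base using () renaming (zero to fz; suc to fs)
open import Data.Nat.ListAction using (sum)
open import Data.Vec using (Vec; []; _∷_)
open import Data.List using (List; []; _∷_; [_]; map; concatMap; upTo; allFin; length; filterᵇ; foldr)
open import Relation.Nullary.Decidable using (⌊_⌋)

allFunctions : (n m : ℕ) → List (Vec (Fin m) n)
allFunctions zero m = [ [] ]
allFunctions (suc n) m = concatMap (λ v → map (λ x → x ∷ v) (allFin m)) (allFunctions n m)

hits : ∀ {n m} → Fin m → Vec (Fin m) n → Bool
hits y [] = false
hits y (x ∷ v) = ⌊ x ≟ y ⌋ ∨ hits y v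

isSurjective : ∀ {n m} → Vec (Fin m) n → Bool
isSurjective {m = m} v = foldr (λ y b → hits y v ∧ b) true (allFin m)

-- number of ordered set partitions of Fin w into exactly m nonempty blocks
-- (= surjections Fin w → Fin m: element i goes to block f i)
orderedPartitionsInto : ℕ → ℕ → ℕ
orderedPartitionsInto w m = length (filterᵇ isSurjective (allFunctions w m))

-- a(w): number of preferential arrangements (ordered set partitions) of a w-set;
-- the number of blocks m ranges over 0..w
a : ℕ → ℕ
a w = sum (map (orderedPartitionsInto w) (upTo (suc w)))

compositions : ℕ → ℕ → List (List ℕ)
compositions zero zero = [ [] ]
compositions zero (suc n) = []
compositions (suc r) n =
  concatMap (λ w → map (w ∷_) (compositions r (n ∸ w))) (upTo (suc n))

-- multinomial n! / (w1! ⋯ wr!) as a product of binomials (parts summing to n)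
multinomial : ℕ → List ℕ → ℕ
multinomial n [] = 1
multinomial n (w ∷ ws) = (n C w) * multinomial (n ∸ w) ws

term : ℕ → List ℕ → ℕ
term n [] = 0
term n (w ∷ ws) = multinomial n (w ∷ ws) * a w

p : ℕ → ℕ → ℕ
p k n = sum (map (term n) (compositions (suc k) n))

-- Classify an arrangement by the size w of its free section: choosing that
-- section and arranging it gives C(n,w)·a(w), and distributing the other n − w
-- elements over the k restricted sections gives k^(n−w), the multinomial theorem
-- at x₁ = ⋯ = x_k = 1.  So p^k_n = Σ_w C(n,w) k^(n−w) a(w); substituting
-- s = n − w and isolating s = n, where a(0) = 1, gives k^n plus the stated sum,
-- and the case k = 0 of the same expansion shows p^0 = a.
module Submission where

open import Defs
open import Data.Nat using (ℕ; _≤_; _+_; _*_; _∸_; _^_)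
open import Data.Nat.Combinatorics using (_C_)
open import Data.List using (map; upTo)
open import Data.Nat.ListAction using (sum)
open import Relation.Binary.PropositionalEquality using (_≡_)

open import Data.Nat using (zero; suc)
open import Data.Nat.Properties
  using ( +-0-commutativeMonoid; +-*-semiring; +-*-commutativeSemiring
        ; *-distribˡ-+; *-distribʳ-+; *-zeroʳ; *-identityˡ; *-identityʳ; +-identityʳ; +-comm
        ; ^-zeroˡ; n∸n≡0; m∸[m∸n]≡n )
open import Data.Nat.Combinatorics using (nCk≡nC[n∸k]; nCn≡1)
open import Data.Nat.ListAction.Properties using (sum-++)
open import Data.List using (List; []; _∷_; applyUpTo; concat; concatMap)
open import Data.List.Properties using (map-cong; map-∘; map-concatMap)
open import Data.Fin using (toℕ; fromℕ; inject₁)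
open import Data.Fin.Properties using (toℕ-fromℕ; toℕ-inject₁; toℕ≤pred[n]; opposite-prop)
open import Data.Fin.Permutation using (reverse)
open import Function using (_∘_)
open import Relation.Binary.PropositionalEquality
  using (refl; sym; trans; cong; cong₂; module ≡-Reasoning)
open import Algebra.Properties.CommutativeMonoid.Sum +-0-commutativeMonoid
  using (sum-syntax; sum⁺-syntax; ∑-permute; sum-init-last; sum-cong-≗; sum-replicate-zero)
open import Algebra.Properties.Semiring.Mult +-*-semiring using (_×_)
open import Algebra.Properties.Semiring.Exp +-*-semiring using () renaming (_^_ to _^ᴬ_)
import Algebra.Properties.CommutativeSemiring.Binomial +-*-commutativeSemiring as Binomial

open ≡-Reasoning

-- The library's binomial theorem uses the semiring-generic _×_ and _^_, which
-- agree with ℕ's _*_ and _^_ only propositionally.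
×≡* : ∀ m x → m × x ≡ m * x
×≡* zero    x = refl
×≡* (suc m) x = cong (x +_) (×≡* m x)

^ᴬ≡^ : ∀ x m → x ^ᴬ m ≡ x ^ m
^ᴬ≡^ x zero    = refl
^ᴬ≡^ x (suc m) = cong (x *_) (^ᴬ≡^ x m)

binomial-theorem : ∀ x y n →
  (x + y) ^ n ≡ ∑[ j ≤ n ] ((n C toℕ j) * (x ^ toℕ j * y ^ (n ∸ toℕ j)))
binomial-theorem x y n = begin
  (x + y) ^ n       ≡⟨ ^ᴬ≡^ (x + y) n ⟨
  (x + y) ^ᴬ n      ≡⟨ Binomial.theorem n x y ⟩
  Binomial.binomialExpansion x y n
    ≡⟨ sum-cong-≗ {suc n} (λ j → trans (×≡* (n C toℕ j) (x ^ᴬ toℕ j * y ^ᴬ (n ∸ toℕ j))) (cong ((n C toℕ j) *_) (cong₂ _*_ (^ᴬ≡^ x (toℕ j)) (^ᴬ≡^ y (n ∸ toℕ j))))) ⟩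
  ∑[ j ≤ n ] ((n C toℕ j) * (x ^ toℕ j * y ^ (n ∸ toℕ j))) ∎

∑-reverse : ∀ n (f : ℕ → ℕ) → ∑[ w ≤ n ] f (toℕ w) ≡ ∑[ s ≤ n ] f (n ∸ toℕ s)
∑-reverse n f = trans (∑-permute (f ∘ toℕ) reverse) (sum-cong-≗ (cong f ∘ opposite-prop))

sum-map-applyUpTo : ∀ (f g : ℕ → ℕ) n → sum (map f (applyUpTo g n)) ≡ ∑[ i < n ] f (g (toℕ i))
sum-map-applyUpTo f g zero    = refl
sum-map-applyUpTo f g (suc n) = cong (f (g 0) +_) (sum-map-applyUpTo f (g ∘ suc) n)

sum-map-upTo : ∀ (f : ℕ → ℕ) n → sum (map f (upTo n)) ≡ ∑[ i < n ] f (toℕ i)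
sum-map-upTo f = sum-map-applyUpTo f (λ i → i)

sum-concat : ∀ (xss : List (List ℕ)) → sum (concat xss) ≡ sum (map sum xss)
sum-concat []         = refl
sum-concat (xs ∷ xss) = trans (sum-++ xs (concat xss)) (cong (sum xs +_) (sum-concat xss))

sum-map-concatMap : ∀ {A B : Set} (f : B → ℕ) (g : A → List B) xs →
  sum (map f (concatMap g xs)) ≡ sum (map (λ x → sum (map f (g x))) xs)
sum-map-concatMap f g xs = begin
  sum (map f (concatMap g xs))                   ≡⟨ cong sum (map-concatMap f g xs) ⟩
  sum (concat (map (map f ∘ g) xs))              ≡⟨ sum-concat (map (map f ∘ g) xs) ⟩
  sum (map sum (map (map f ∘ g) xs))             ≡⟨ cong sum (map-∘ xs) ⟨
  sum (map (λ x → sum (map f (g x))) xs)         ∎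

sum-map-*ˡ : ∀ {A : Set} c (f : A → ℕ) xs → sum (map (λ x → c * f x) xs) ≡ c * sum (map f xs)
sum-map-*ˡ c f []       = sym (*-zeroʳ c)
sum-map-*ˡ c f (x ∷ xs) = trans (cong (c * f x +_) (sum-map-*ˡ c f xs)) (sym (*-distribˡ-+ c (f x) _))

sum-map-*ʳ : ∀ {A : Set} c (f : A → ℕ) xs → sum (map (λ x → f x * c) xs) ≡ sum (map f xs) * c
sum-map-*ʳ c f []       = refl
sum-map-*ʳ c f (x ∷ xs) = trans (cong (f x * c +_) (sum-map-*ʳ c f xs)) (sym (*-distribʳ-+ c (f x) _))

sum-map-compositions-suc : ∀ (F : List ℕ → ℕ) r n →
  sum (map F (compositions (suc r) n)) ≡
  ∑[ w ≤ n ] sum (map (λ ws → F (toℕ w ∷ ws)) (compositions r (n ∸ toℕ w)))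
sum-map-compositions-suc F r n = begin
  sum (map F (compositions (suc r) n))
    ≡⟨ sum-map-concatMap F (λ w → map (w ∷_) (compositions r (n ∸ w))) (upTo (suc n)) ⟩
  sum (map (λ w → sum (map F (map (w ∷_) (compositions r (n ∸ w))))) (upTo (suc n)))
    ≡⟨ sum-map-upTo (λ w → sum (map F (map (w ∷_) (compositions r (n ∸ w))))) (suc n) ⟩
  ∑[ w ≤ n ] sum (map F (map (toℕ w ∷_) (compositions r (n ∸ toℕ w))))
    ≡⟨ sum-cong-≗ {suc n} (λ w → cong sum (map-∘ {g = F} {f = toℕ w ∷_} (compositions r (n ∸ toℕ w)))) ⟨
  ∑[ w ≤ n ] sum (map (λ ws → F (toℕ w ∷ ws)) (compositions r (n ∸ toℕ w))) ∎

sum-multinomial≡^ : ∀ r m → sum (map (multinomial m) (compositions r m)) ≡ r ^ m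
sum-multinomial≡^ zero    zero    = refl
sum-multinomial≡^ zero    (suc m) = refl
sum-multinomial≡^ (suc r) m = begin
  sum (map (multinomial m) (compositions (suc r) m))
    ≡⟨ sum-map-compositions-suc (multinomial m) r m ⟩
  ∑[ w ≤ m ] sum (map (λ ws → (m C toℕ w) * multinomial (m ∸ toℕ w) ws) (compositions r (m ∸ toℕ w)))
    ≡⟨ sum-cong-≗ {suc m} (λ w → trans (sum-map-*ˡ (m C toℕ w) (multinomial (m ∸ toℕ w)) (compositions r (m ∸ toℕ w))) (cong ((m C toℕ w) *_) (sum-multinomial≡^ r (m ∸ toℕ w)))) ⟩
  ∑[ w ≤ m ] ((m C toℕ w) * r ^ (m ∸ toℕ w))
    ≡⟨ sum-cong-≗ {suc m} (λ w → cong ((m C toℕ w) *_) (trans (cong (_* r ^ (m ∸ toℕ w)) (^-zeroˡ (toℕ w))) (*-identityˡ (r ^ (m ∸ toℕ w))))) ⟨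
  ∑[ w ≤ m ] ((m C toℕ w) * (1 ^ toℕ w * r ^ (m ∸ toℕ w)))
    ≡⟨ binomial-theorem 1 r m ⟨
  suc r ^ m ∎

p≡∑-free-section : ∀ k n → p k n ≡ ∑[ w ≤ n ] ((n C toℕ w) * k ^ (n ∸ toℕ w) * a (toℕ w))
p≡∑-free-section k n = begin
  p k n
    ≡⟨ sum-map-compositions-suc (term n) k n ⟩
  ∑[ w ≤ n ] sum (map (λ ws → (n C toℕ w) * multinomial (n ∸ toℕ w) ws * a (toℕ w)) (compositions k (n ∸ toℕ w)))
    ≡⟨ sum-cong-≗ {suc n} (count ∘ toℕ) ⟩
  ∑[ w ≤ n ] ((n C toℕ w) * k ^ (n ∸ toℕ w) * a (toℕ w)) ∎
  where
  count : ∀ w → sum (map (λ ws → (n C w) * multinomial (n ∸ w) ws * a w) (compositions k (n ∸ w)))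
                ≡ (n C w) * k ^ (n ∸ w) * a w
  count w = begin
    sum (map (λ ws → (n C w) * multinomial (n ∸ w) ws * a w) (compositions k (n ∸ w)))
      ≡⟨ sum-map-*ʳ (a w) (λ ws → (n C w) * multinomial (n ∸ w) ws) (compositions k (n ∸ w)) ⟩
    sum (map (λ ws → (n C w) * multinomial (n ∸ w) ws) (compositions k (n ∸ w))) * a w
      ≡⟨ cong (_* a w) (sum-map-*ˡ (n C w) (multinomial (n ∸ w)) (compositions k (n ∸ w))) ⟩
    (n C w) * sum (map (multinomial (n ∸ w)) (compositions k (n ∸ w))) * a w
      ≡⟨ cong (λ m → (n C w) * m * a w) (sum-multinomial≡^ k (n ∸ w)) ⟩
    (n C w) * k ^ (n ∸ w) * a w ∎

p≡∑-restricted-sections : ∀ k n → p k n ≡ ∑[ s ≤ n ] ((n C toℕ s) * k ^ toℕ s * a (n ∸ toℕ s))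
p≡∑-restricted-sections k n = begin
  p k n                               ≡⟨ p≡∑-free-section k n ⟩
  ∑[ w ≤ n ] free-term (toℕ w)        ≡⟨ ∑-reverse n free-term ⟩
  ∑[ s ≤ n ] free-term (n ∸ toℕ s)    ≡⟨ sum-cong-≗ {suc n} (λ s → complement (toℕ≤pred[n] s)) ⟩
  ∑[ s ≤ n ] ((n C toℕ s) * k ^ toℕ s * a (n ∸ toℕ s)) ∎
  where
  free-term : ℕ → ℕ
  free-term w = (n C w) * k ^ (n ∸ w) * a w
  complement : ∀ {s} → s ≤ n → free-term (n ∸ s) ≡ (n C s) * k ^ s * a (n ∸ s)
  complement {s} s≤n = cong₂ (λ c e → c * k ^ e * a (n ∸ s)) (sym (nCk≡nC[n∸k] s≤n)) (m∸[m∸n]≡n s≤n)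

p-zero≡a : ∀ n → p 0 n ≡ a n
p-zero≡a n = begin
  -- n C 0 and 0 ^ suc i compute to 1 and 0 * 0 ^ i.
  p 0 n
    ≡⟨ p≡∑-restricted-sections 0 n ⟩
  (n C 0) * 1 * a n + ∑[ s < n ] ((n C suc (toℕ s)) * 0 * a (n ∸ suc (toℕ s)))
    ≡⟨ cong₂ _+_ (*-identityˡ (a n)) (sum-cong-≗ {n} (λ s → cong (_* a (n ∸ suc (toℕ s))) (*-zeroʳ (n C suc (toℕ s))))) ⟩
  a n + ∑[ s < n ] 0
    ≡⟨ cong (a n +_) (sum-replicate-zero n) ⟩
  a n + 0
    ≡⟨ +-identityʳ (a n) ⟩
  a n ∎

p-recurrence : ∀ k n → p k n ≡ k ^ n + sum (map (λ s → (n C s) * k ^ s * p 0 (n ∸ s)) (upTo n))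
p-recurrence k n = begin
  p k n                                          ≡⟨ p≡∑-restricted-sections k n ⟩
  ∑[ s ≤ n ] restricted-term (toℕ s)             ≡⟨ sum-init-last {n} (restricted-term ∘ toℕ) ⟩
  ∑[ s < n ] restricted-term (toℕ (inject₁ s)) + restricted-term (toℕ (fromℕ n))
    ≡⟨ cong₂ _+_ (sum-cong-≗ {n} (λ s → cong restricted-term (toℕ-inject₁ s))) (cong restricted-term (toℕ-fromℕ n)) ⟩
  ∑[ s < n ] restricted-term (toℕ s) + restricted-term n
    ≡⟨ cong₂ _+_ (sym (sum-map-upTo restricted-term n)) all-restricted ⟩
  sum (map restricted-term (upTo n)) + k ^ n     ≡⟨ +-comm _ (k ^ n) ⟩
  k ^ n + sum (map restricted-term (upTo n))
    ≡⟨ cong (λ t → k ^ n + sum t) (map-cong (λ s → cong ((n C s) * k ^ s *_) (p-zero≡a (n ∸ s))) (upTo n)) ⟨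
  k ^ n + sum (map (λ s → (n C s) * k ^ s * p 0 (n ∸ s)) (upTo n)) ∎
  where
  restricted-term : ℕ → ℕ
  restricted-term s = (n C s) * k ^ s * a (n ∸ s)
  all-restricted : restricted-term n ≡ k ^ n
  all-restricted = begin
    (n C n) * k ^ n * a (n ∸ n)  ≡⟨ cong₂ (λ c e → c * k ^ n * a e) (nCn≡1 n) (n∸n≡0 n) ⟩
    1 * k ^ n * 1                ≡⟨ *-identityʳ (1 * k ^ n) ⟩
    1 * k ^ n                    ≡⟨ *-identityˡ (k ^ n) ⟩
    k ^ n                        ∎

lemma1 : (k n : ℕ) → 1 ≤ k → 1 ≤ n →
         p k n ≡ k ^ n + sum (map (λ s → (n C s) * k ^ s * p 0 (n ∸ s)) (upTo n))
lemma1 k n _ _ = p-recurrence k n
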